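{- Let $\lambda$ be a partition and $n\ge 1$. The destandardization map $\mathrm{dst}$ is well defined and satisfies: (1) for $T\in\mathrm{SSYT}_n(\lambda)$, $\mathrm{dst}(T)\in\mathrm{QYT}_n(\lambda)$; (2) for $T\in\mathrm{SSYT}_n(\lambda)$, $\mathrm{dst}(T)=T$ if and only if $T\in\mathrm{QYT}_n(\lambda)$; (3) $\mathrm{dst}:\mathrm{SSYT}_n(\lambda)\to\mathrm{QYT}_n(\lambda)$ is surjective; (4) $\mathrm{dst}:\mathrm{SSYT}_n(\lambda)\to\mathrm{QYT}_n(\lambda)$ is injective if and only if $n\le \ell(\lambda)$, where $\ell(\lambda)$ is the number of nonzero parts of $\lambda$.
   Context: Partitions are drawn in French notation: the diagram of $\lambda=(\lambda_1\ge\dots\ge\lambda_\ell>0)$ is the set of cells $(i,j)$ with $1\le i\le\lambda_j$ ($i$ = column, $j$ = row, rows numbered from the bottom). A semistandard Young tableau of shape $\lambda$ is a filling $T$ of the cells by positive integers, weakly increasing left to right along rows and strictly increasing from bottom to top in columns; $\mathrm{SSYT}_n(\lambda)$ is the set of those with all entries in $\{1,\dots,n\}$. A semistandard tableau $T$ is quasi-Yamanouchi if for every $i>1$ that occurs in $T$, the leftmost occurrence of $i$ lies in a column weakly left of (i.e. column index $\le$) the column of some occurrence of $i-1$; $\mathrm{QYT}_n(\lambda)$ denotes the quasi-Yamanouchi tableaux in $\mathrm{SSYT}_n(\lambda)$. The destandardization $\mathrm{dst}(T)$ is obtained from $T$ as follows: whenever there is some $i>1$ occurring in $T$ whose leftmost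 occurrence lies strictly right of the rightmost occurrence of $i-1$ (including the case that $i-1$ does not occur), replace every entry $i$ by $i-1$; repeat until no such $i$ exists. -}

module Defs where

open import Data.Nat using (ℕ; zero; suc; _≤_; _<_; _≥_; _≡ᵇ_)
open import Data.List using (List; []; _∷_; map; length)
open import Data.List.Relation.Unary.All using (All)
open import Data.List.Relation.Unary.Linked using (Linked)
open import Data.Maybe using (Maybe; just; nothing)
open import Data.Product using (Σ; ∃; ∃-syntax; _×_; _,_)
open import Data.Bool using (if_then_else_)
open import Relation.Binary.PropositionalEquality using (_≡_)
open import Relation.Binary.Construct.Closure.ReflexiveTransitive using (Star)
open import Relation.Nullary using (¬_)

IsPartition : List ℕ → Set
IsPartition sh = Linked _≥_ sh × All (λ x → 0 < x) sh

ℓ : List ℕ → ℕ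
ℓ = length

-- A filling of a (French) diagram: list of rows, row 0 is the bottom row;
-- the k-th element of a row is the entry in column k (columns from 0, left to right).
Tableau : Set
Tableau = List (List ℕ)

_!!_ : {A : Set} → List A → ℕ → Maybe A
[] !! _ = nothing
(x ∷ xs) !! zero = just x
(x ∷ xs) !! suc k = xs !! k

at : Tableau → ℕ → ℕ → Maybe ℕ
at T c r with T !! r
... | nothing = nothing
... | just row = row !! c

HasShape : List ℕ → Tableau → Set
HasShape sh T = map length T ≡ sh

SSYT : ℕ → List ℕ → Tableau → Set
SSYT n sh T =
  HasShape sh T ×
  (∀ c r a b → at T c r ≡ just a → at T (suc c) r ≡ just b → a ≤ b) ×
  (∀ c r a b → at T c r ≡ just a → at T c (suc r) ≡ just b → a < b) ×
  (∀ c r a → at T c r ≡ just a → 1 ≤ a × a ≤ n)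

LeftmostCol : Tableau → ℕ → ℕ → Set
LeftmostCol T v c =
  (∃[ r ] at T c r ≡ just v) × (∀ c' r' → at T c' r' ≡ just v → c ≤ c')

IsQY : Tableau → Set
IsQY T = ∀ v → 1 ≤ v → ∀ c → LeftmostCol T (suc v) c →
  ∃[ c' ] ∃[ r' ] (at T c' r' ≡ just v × c ≤ c')

QYT : ℕ → List ℕ → Tableau → Set
QYT n sh T = SSYT n sh T × IsQY T

lowerEntry : ℕ → Tableau → Tableau
lowerEntry v T = map (map (λ x → if x ≡ᵇ suc v then v else x)) T

DstStep : Tableau → Tableau → Set
DstStep T T' = ∃[ v ] (1 ≤ v ×
  (∃[ c ] (LeftmostCol T (suc v) c × (∀ c' r' → at T c' r' ≡ just v → c' < c))) ×
  T' ≡ lowerEntry v T)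

DstReach : Tableau → Tableau → Set
DstReach = Star DstStep

DstNormal : Tableau → Set
DstNormal T = ¬ (∃[ T' ] DstStep T T')

-- Each destandardization step strictly lowers the sum of the entries, and two steps can always be
-- rejoined (they commute unless they lower adjacent values), so by Newman's lemma every tableau has
-- a unique normal form dst T. Normal forms are exactly the quasi-Yamanouchi tableaux, and steps
-- preserve semistandardness. For (4): when n ≤ ℓ the first column forces every semistandard tableau
-- to be quasi-Yamanouchi, while for ℓ < n two different staircase tableaux have the same image.

module Submission where

open import Defs
open import Data.Bool using (true; false; if_then_else_) renaming (T to IsTrue)
open import Data.List using (List; []; _∷_; _++_; map; length; replicate)
open import Data.List.Properties using (map-∘; map-cong; length-map; length-replicate; map-replicate)
open import Data.List.Membership.Propositional using (_∈_; find; lose)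
open import Data.List.Membership.Propositional.Properties using (∈-map⁺; ∈-map⁻; ∈-++⁺ˡ; ∈-++⁺ʳ; ∈-++⁻)
open import Data.List.Relation.Unary.All as All using (All; _∷_; all?)
open import Data.List.Relation.Unary.Any using (here; there; any?)
open import Data.Maybe using (just; nothing)
import Data.Maybe as Maybe
open import Data.Maybe.Properties using (just-injective)
open import Data.Nat using (ℕ; zero; suc; pred; _+_; _∸_; _≤_; _<_; _≡ᵇ_; z≤n; s≤s; z<s; _≟_; _≤?_; _<?_)
open import Data.Nat.Properties
open import Data.Nat.Induction using (<-wellFounded)
open import Data.Nat.ListAction using (sum)
open import Data.Product using (Σ; ∃; ∃-syntax; -,_; _×_; _,_; proj₁; proj₂; map₁; map₂; swap)
open import Data.Sum using (_⊎_; inj₁; inj₂)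
open import Data.Unit using (tt)
open import Function using (_∘_; flip)
open import Function.Bundles using (_⇔_; mk⇔)
open import Induction.WellFounded using (Acc; acc; module Subrelation)
open import Relation.Binary.Core using (Rel)
import Relation.Binary.Construct.On as On
open import Relation.Binary.Construct.Closure.ReflexiveTransitive using (Star; ε; _◅_)
open import Relation.Binary.Construct.Closure.Transitive using (Plus; [_]; _∼⁺⟨_⟩_)
open import Relation.Binary.Rewriting
  using (IsNormalForm; HasNormalForm; Confluent; WeaklyConfluent; StronglyNormalizing; sn&wcr⇒cr)
open import Relation.Binary.PropositionalEquality
open import Relation.Nullary using (¬_; Dec; yes; no; contradiction)
open import Relation.Nullary.Decidable using (map′; _×-dec_; _→-dec_)

lower : ℕ → ℕ → ℕ
lower v x = if x ≡ᵇ suc v then v else x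

lower-cases : ∀ v x → (x ≡ suc v × lower v x ≡ v) ⊎ (x ≢ suc v × lower v x ≡ x)
lower-cases v x with x ≡ᵇ suc v in eq
... | true  = inj₁ (≡ᵇ⇒≡ x (suc v) (subst IsTrue (sym eq) tt) , refl)
... | false = inj₂ ((λ x≡1+v → subst IsTrue eq (≡⇒≡ᵇ x (suc v) x≡1+v)) , refl)

lower-suc : ∀ v → lower v (suc v) ≡ v
lower-suc v with lower-cases v (suc v)
... | inj₁ (_ , e) = e
... | inj₂ (ne , _) = contradiction refl ne

lower-≢ : ∀ {v x} → x ≢ suc v → lower v x ≡ x
lower-≢ {v} {x} ne with lower-cases v x
... | inj₁ (e , _) = contradiction e ne
... | inj₂ (_ , e) = e

lower-≤ : ∀ v x → lower v x ≤ x
lower-≤ v x with lower-cases v x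
... | inj₁ (refl , e) = subst (_≤ suc v) (sym e) (n≤1+n v)
... | inj₂ (_ , e) = ≤-reflexive e

lower-≥ : ∀ {m v x} → m ≤ v → m ≤ x → m ≤ lower v x
lower-≥ {m} {v} {x} m≤v m≤x with lower-cases v x
... | inj₁ (_ , e) = subst (m ≤_) (sym e) m≤v
... | inj₂ (_ , e) = subst (m ≤_) (sym e) m≤x

lower-mono-≤ : ∀ v {x y} → x ≤ y → lower v x ≤ lower v y
lower-mono-≤ v {x} {y} x≤y with lower-cases v x | lower-cases v y
... | inj₁ (_ , ex)    | inj₁ (_ , ey)    = ≤-reflexive (trans ex (sym ey))
... | inj₁ (refl , ex) | inj₂ (_ , ey)    = subst₂ _≤_ (sym ex) (sym ey) (≤-trans (n≤1+n v) x≤y)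
... | inj₂ (x≢ , ex)   | inj₁ (refl , ey) = subst₂ _≤_ (sym ex) (sym ey) (≤-pred (≤∧≢⇒< x≤y x≢))
... | inj₂ (_ , ex)    | inj₂ (_ , ey)    = subst₂ _≤_ (sym ex) (sym ey) x≤y

lower-mono-< : ∀ v {x y} → x < y → ¬ (x ≡ v × y ≡ suc v) → lower v x < lower v y
lower-mono-< v {x} {y} x<y not-v,1+v with lower-cases v x | lower-cases v y
... | inj₁ (refl , _)  | inj₁ (refl , _)  = contradiction x<y (<-irrefl refl)
... | inj₁ (refl , ex) | inj₂ (_ , ey)    = subst₂ _<_ (sym ex) (sym ey) (<-trans (n<1+n v) x<y)
... | inj₂ (x≢ , ex)   | inj₁ (refl , ey) =
  subst₂ _<_ (sym ex) (sym ey) (≤∧≢⇒< (≤-pred x<y) (λ x≡v → not-v,1+v (x≡v , refl)))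
... | inj₂ (_ , ex)    | inj₂ (_ , ey)    = subst₂ _<_ (sym ex) (sym ey) x<y

lower-lower-adjacent : ∀ v x → lower v (lower (suc v) x) ≡ lower v (lower (suc v) (lower v x))
lower-lower-adjacent v x with lower-cases v x
... | inj₂ (_ , lower-x) = cong (lower v ∘ lower (suc v)) (sym lower-x)
... | inj₁ (refl , lower-x) = begin
  lower v (lower (suc v) (suc v))            ≡⟨ cong (lower v) (lower-≢ (<⇒≢ (n<1+n (suc v)))) ⟩
  lower v (suc v)                            ≡⟨ lower-suc v ⟩
  v                                          ≡⟨ lower-≢ (<⇒≢ (n<1+n v)) ⟨
  lower v v                                  ≡⟨ cong (lower v) (lower-≢ (m≢1+n+m v {1})) ⟨
  lower v (lower (suc v) v)                  ≡⟨ cong (lower v ∘ lower (suc v)) lower-x ⟨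
  lower v (lower (suc v) (lower v (suc v)))  ∎
  where open ≡-Reasoning

lower-lower-comm : ∀ {v w} x → v ≢ w → w ≢ suc v → v ≢ suc w →
  lower w (lower v x) ≡ lower v (lower w x)
lower-lower-comm {v} {w} x v≢w w≢1+v v≢1+w with lower-cases v x | lower-cases w x
... | inj₁ (refl , _)  | inj₁ (e , _)     = contradiction (suc-injective e) v≢w
... | inj₁ (refl , ev) | inj₂ (_ , ew)    =
  trans (cong (lower w) ev) (trans (lower-≢ v≢1+w) (sym (trans (cong (lower v) ew) ev)))
... | inj₂ (_ , ev)    | inj₁ (refl , ew) =
  trans (cong (lower w) ev) (sym (trans (cong (lower v) ew) (trans (lower-≢ w≢1+v) (sym ew))))
... | inj₂ (_ , ev)    | inj₂ (_ , ew)    =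
  trans (cong (lower w) ev) (trans ew (sym (trans (cong (lower v) ew) ev)))

-- lowerEntry v is definitionally mapEntries (lower v); the lemmas below rely on this.
mapEntries : (ℕ → ℕ) → Tableau → Tableau
mapEntries f = map (map f)

mapEntries-∘ : ∀ f g T → mapEntries f (mapEntries g T) ≡ mapEntries (f ∘ g) T
mapEntries-∘ f g T = sym (trans (map-cong (map-∘ {g = f} {f = g}) T) (map-∘ T))

mapEntries-cong : ∀ {f g} → (∀ x → f x ≡ g x) → ∀ T → mapEntries f T ≡ mapEntries g T
mapEntries-cong f≗g = map-cong (map-cong f≗g)

shape-mapEntries : ∀ f T → map length (mapEntries f T) ≡ map length T
shape-mapEntries f T = trans (sym (map-∘ T)) (map-cong (length-map f) T)

!!-map : ∀ {A B : Set} (f : A → B) xs k → map f xs !! k ≡ Maybe.map f (xs !! k)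
!!-map f []       k       = refl
!!-map f (x ∷ xs) zero    = refl
!!-map f (x ∷ xs) (suc k) = !!-map f xs k

at-mapEntries : ∀ f T c r → at (mapEntries f T) c r ≡ Maybe.map f (at T c r)
at-mapEntries f []        c r       = refl
at-mapEntries f (row ∷ T) c zero    = !!-map f row c
at-mapEntries f (row ∷ T) c (suc r) = at-mapEntries f T c r

at-mapEntries⁻ : ∀ f T c r {y} → at (mapEntries f T) c r ≡ just y →
  ∃[ x ] (at T c r ≡ just x × f x ≡ y)
at-mapEntries⁻ f T c r e with at T c r | at-mapEntries f T c r
... | just x  | eq = x , refl , just-injective (trans (sym eq) e)
... | nothing | eq = contradiction (trans (sym eq) e) λ ()

at-lowerEntry : ∀ v T c r {x} → at T c r ≡ just x → at (lowerEntry v T) c r ≡ just (lower v x)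
at-lowerEntry v T c r e = trans (at-mapEntries (lower v) T c r) (cong (Maybe.map (lower v)) e)

at-lowerEntry-suc : ∀ v T c r → at T c r ≡ just (suc v) → at (lowerEntry v T) c r ≡ just v
at-lowerEntry-suc v T c r e = trans (at-lowerEntry v T c r e) (cong just (lower-suc v))

at-lowerEntry-≢ : ∀ v T c r {y} → at T c r ≡ just y → y ≢ suc v → at (lowerEntry v T) c r ≡ just y
at-lowerEntry-≢ v T c r e y≢ = trans (at-lowerEntry v T c r e) (cong just (lower-≢ y≢))

at-lowerEntry⁻-≢ : ∀ v T c r {y} → at (lowerEntry v T) c r ≡ just y → y ≢ v → at T c r ≡ just y
at-lowerEntry⁻-≢ v T c r e y≢v with x , ex , refl ← at-mapEntries⁻ (lower v) T c r e with lower-cases v x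
... | inj₁ (_ , lower-x) = contradiction lower-x y≢v
... | inj₂ (_ , lower-x) = trans ex (cong just (sym lower-x))

at-lowerEntry⁻-v : ∀ v T c r → at (lowerEntry v T) c r ≡ just v →
  at T c r ≡ just v ⊎ at T c r ≡ just (suc v)
at-lowerEntry⁻-v v T c r e with x , ex , lower-x≡v ← at-mapEntries⁻ (lower v) T c r e with lower-cases v x
... | inj₁ (refl , _)    = inj₂ ex
... | inj₂ (_ , lower-x) = inj₁ (trans ex (cong just (trans (sym lower-x) lower-x≡v)))

at-lowerEntry-≢suc : ∀ v T c r → at (lowerEntry v T) c r ≢ just (suc v)
at-lowerEntry-≢suc v T c r e with x , _ , lower-x≡1+v ← at-mapEntries⁻ (lower v) T c r e with lower-cases v x
... | inj₁ (_ , lower-x)   = 1+n≢n (trans (sym lower-x≡1+v) lower-x)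
... | inj₂ (x≢ , lower-x) = x≢ (trans (sym lower-x) lower-x≡1+v)

entrySum : Tableau → ℕ
entrySum T = sum (map sum T)

sum-map-≤ : ∀ {f} → (∀ x → f x ≤ x) → ∀ xs → sum (map f xs) ≤ sum xs
sum-map-≤ f≤ []       = z≤n
sum-map-≤ f≤ (x ∷ xs) = +-mono-≤ (f≤ x) (sum-map-≤ f≤ xs)

sum-map-< : ∀ {f} → (∀ x → f x ≤ x) → ∀ xs c {a} → xs !! c ≡ just a → f a < a →
  sum (map f xs) < sum xs
sum-map-< f≤ (x ∷ xs) zero    refl fa<a = +-mono-<-≤ fa<a (sum-map-≤ f≤ xs)
sum-map-< f≤ (x ∷ xs) (suc c) e    fa<a = +-mono-≤-< (f≤ x) (sum-map-< f≤ xs c e fa<a)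

entrySum-mapEntries-≤ : ∀ {f} → (∀ x → f x ≤ x) → ∀ T → entrySum (mapEntries f T) ≤ entrySum T
entrySum-mapEntries-≤ f≤ []        = z≤n
entrySum-mapEntries-≤ f≤ (row ∷ T) = +-mono-≤ (sum-map-≤ f≤ row) (entrySum-mapEntries-≤ f≤ T)

entrySum-mapEntries-< : ∀ {f} → (∀ x → f x ≤ x) → ∀ T c r {a} → at T c r ≡ just a → f a < a →
  entrySum (mapEntries f T) < entrySum T
entrySum-mapEntries-< f≤ (row ∷ T) c zero    e fa<a =
  +-mono-<-≤ (sum-map-< f≤ row c e fa<a) (entrySum-mapEntries-≤ f≤ T)
entrySum-mapEntries-< f≤ (row ∷ T) c (suc r) e fa<a =
  +-mono-≤-< (sum-map-≤ f≤ row) (entrySum-mapEntries-< f≤ T c r e fa<a)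

step-entrySum< : ∀ {T T′} → DstStep T T′ → entrySum T′ < entrySum T
step-entrySum< {T} (v , _ , (c , ((r , e) , _) , _) , refl) =
  entrySum-mapEntries-< (lower-≤ v) T c r e (≤-<-trans (≤-reflexive (lower-suc v)) (n<1+n v))

plus-entrySum< : ∀ {T T′} → Plus DstStep T T′ → entrySum T′ < entrySum T
plus-entrySum< [ s ]           = step-entrySum< s
plus-entrySum< (_ ∼⁺⟨ p ⟩ q) = <-trans (plus-entrySum< q) (plus-entrySum< p)

dst⁺-stronglyNormalizing : StronglyNormalizing (Plus DstStep)
dst⁺-stronglyNormalizing =
  Subrelation.wellFounded {_<₁_ = flip (Plus DstStep)} plus-entrySum< (On.wellFounded entrySum <-wellFounded)

dst-stronglyNormalizing : StronglyNormalizing DstStep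
dst-stronglyNormalizing = Subrelation.wellFounded {_<₁_ = flip DstStep} [_] dst⁺-stronglyNormalizing

AllLeftOf : Tableau → ℕ → ℕ → Set
AllLeftOf T v c = ∀ c′ r′ → at T c′ r′ ≡ just v → c′ < c

lowering-step : ∀ {T} v c → 1 ≤ v → LeftmostCol T (suc v) c → AllLeftOf T v c → DstStep T (lowerEntry v T)
lowering-step v c 1≤v leftmost left = v , 1≤v , (c , leftmost , left) , refl

lowering-condition-stable : ∀ T v w c → w ≢ v → suc w ≢ v →
  LeftmostCol T (suc w) c → AllLeftOf T w c →
  LeftmostCol (lowerEntry v T) (suc w) c × AllLeftOf (lowerEntry v T) w c
lowering-condition-stable T v w c w≢v 1+w≢v ((r , e) , leftmost) left =
  ((r , at-lowerEntry-≢ v T c r e (w≢v ∘ suc-injective)) ,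
   λ c′ r′ e′ → leftmost c′ r′ (at-lowerEntry⁻-≢ v T c′ r′ e′ 1+w≢v)) ,
  λ c′ r′ e′ → left c′ r′ (at-lowerEntry⁻-≢ v T c′ r′ e′ w≢v)

Joinable : Tableau → Tableau → Set
Joinable T₁ T₂ = ∃[ U ] (DstReach T₁ U × DstReach T₂ U)

-- Both orders end by turning every v+1 and v+2 into v.
adjacent-joinable : ∀ T v cv cw → 1 ≤ v →
  LeftmostCol T (suc v) cv → AllLeftOf T v cv →
  LeftmostCol T (suc (suc v)) cw → AllLeftOf T (suc v) cw →
  Joinable (lowerEntry v T) (lowerEntry (suc v) T)
adjacent-joinable T v cv cw 1≤v ((rv , ev) , leftmost-v) left-v leftmost₊@((rw , ew) , leftmost-w) left-w =
  U , step-w ◅ step-v ◅ ε , step-v′ ◅ ε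
  where
  T₁ = lowerEntry v T
  U  = lowerEntry v (lowerEntry (suc v) T)

  1+v≢v : suc v ≢ v
  1+v≢v = 1+n≢n

  2+v≢v : suc (suc v) ≢ v
  2+v≢v = m≢1+n+m v {1} ∘ sym

  cv<cw : cv < cw
  cv<cw = left-w cv rv ev

  step-w : DstStep T₁ (lowerEntry (suc v) T₁)
  step-w = let leftmost′ , left′ = lowering-condition-stable T v (suc v) cw 1+v≢v 2+v≢v leftmost₊ left-w
           in lowering-step (suc v) cw z<s leftmost′ left′

  leftmost-in-T₁ : ∀ c′ r′ → at T₁ c′ r′ ≡ just (suc v) ⊎ at T₁ c′ r′ ≡ just (suc (suc v)) →
                   cw ≤ c′
  leftmost-in-T₁ c′ r′ (inj₁ e) = contradiction e (at-lowerEntry-≢suc v T c′ r′)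
  leftmost-in-T₁ c′ r′ (inj₂ e) = leftmost-w c′ r′ (at-lowerEntry⁻-≢ v T c′ r′ e 2+v≢v)

  left-in-T : ∀ c′ r′ → at T c′ r′ ≡ just v ⊎ at T c′ r′ ≡ just (suc v) → c′ < cw
  left-in-T c′ r′ (inj₁ e) = <-trans (left-v c′ r′ e) cv<cw
  left-in-T c′ r′ (inj₂ e) = left-w c′ r′ e

  merged : U ≡ lowerEntry v (lowerEntry (suc v) T₁)
  merged = begin
    lowerEntry v (lowerEntry (suc v) T)           ≡⟨ mapEntries-∘ (lower v) (lower (suc v)) T ⟩
    mapEntries (lower v ∘ lower (suc v)) T        ≡⟨ mapEntries-cong (lower-lower-adjacent v) T ⟩
    mapEntries (lower v ∘ lower (suc v) ∘ lower v) T
      ≡⟨ mapEntries-∘ (lower v ∘ lower (suc v)) (lower v) T ⟨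
    mapEntries (lower v ∘ lower (suc v)) T₁       ≡⟨ mapEntries-∘ (lower v) (lower (suc v)) T₁ ⟨
    lowerEntry v (lowerEntry (suc v) T₁)          ∎
    where open ≡-Reasoning

  step-v : DstStep (lowerEntry (suc v) T₁) U
  step-v = subst (DstStep _) (sym merged) (lowering-step v cw 1≤v
    ((rw , at-lowerEntry-suc (suc v) T₁ cw rw (at-lowerEntry-≢ v T cw rw ew (1+v≢v ∘ suc-injective))) ,
     λ c′ r′ e → leftmost-in-T₁ c′ r′ (at-lowerEntry⁻-v (suc v) T₁ c′ r′ e))
    λ c′ r′ e → left-in-T c′ r′
      (at-lowerEntry⁻-v v T c′ r′ (at-lowerEntry⁻-≢ (suc v) T₁ c′ r′ e (1+v≢v ∘ sym))))

  leftmost-in-T : ∀ c′ r′ → at T c′ r′ ≡ just (suc v) ⊎ at T c′ r′ ≡ just (suc (suc v)) →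
                  cv ≤ c′
  leftmost-in-T c′ r′ (inj₁ e) = leftmost-v c′ r′ e
  leftmost-in-T c′ r′ (inj₂ e) = <⇒≤ (<-≤-trans cv<cw (leftmost-w c′ r′ e))

  step-v′ : DstStep (lowerEntry (suc v) T) U
  step-v′ = lowering-step v cv 1≤v
    ((rv , at-lowerEntry-≢ (suc v) T cv rv ev (<⇒≢ (n<1+n (suc v)))) ,
     λ c′ r′ e → leftmost-in-T c′ r′ (at-lowerEntry⁻-v (suc v) T c′ r′ e))
    λ c′ r′ e → left-v c′ r′ (at-lowerEntry⁻-≢ (suc v) T c′ r′ e (1+v≢v ∘ sym))

local-confluence : WeaklyConfluent DstStep
local-confluence {T} (v , 1≤v , (cv , leftmost-v , left-v) , refl)
                     (w , 1≤w , (cw , leftmost-w , left-w) , refl) with v ≟ w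
... | yes refl = lowerEntry v T , ε , ε
... | no v≢w with w ≟ suc v
...   | yes refl = adjacent-joinable T v cv cw 1≤v leftmost-v left-v leftmost-w left-w
...   | no w≢1+v with v ≟ suc w
...     | yes refl = map₂ swap (adjacent-joinable T w cw cv 1≤w leftmost-w left-w leftmost-v left-v)
...     | no v≢1+w = lowerEntry w (lowerEntry v T) , step-w ◅ ε , step-v ◅ ε
  where
  step-w : DstStep (lowerEntry v T) (lowerEntry w (lowerEntry v T))
  step-w = let leftmost′ , left′ = lowering-condition-stable T v w cw (v≢w ∘ sym) (v≢1+w ∘ sym)
                                                             leftmost-w left-w
           in lowering-step w cw 1≤w leftmost′ left′

  commute : lowerEntry w (lowerEntry v T) ≡ lowerEntry v (lowerEntry w T)
  commute = begin
    lowerEntry w (lowerEntry v T)     ≡⟨ mapEntries-∘ (lower w) (lower v) T ⟩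
    mapEntries (lower w ∘ lower v) T  ≡⟨ mapEntries-cong (λ x → lower-lower-comm x v≢w w≢1+v v≢1+w) T ⟩
    mapEntries (lower v ∘ lower w) T  ≡⟨ mapEntries-∘ (lower v) (lower w) T ⟨
    lowerEntry v (lowerEntry w T)     ∎
    where open ≡-Reasoning

  step-v : DstStep (lowerEntry w T) (lowerEntry w (lowerEntry v T))
  step-v = let leftmost′ , left′ = lowering-condition-stable T w v cv v≢w (w≢1+v ∘ sym)
                                                             leftmost-v left-v
           in subst (DstStep _) (sym commute) (lowering-step v cv 1≤v leftmost′ left′)

rowCells : List ℕ → List (ℕ × ℕ)
rowCells []       = []
rowCells (x ∷ xs) = (0 , x) ∷ map (map₁ suc) (rowCells xs)

cells : Tableau → List (ℕ × ℕ × ℕ)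
cells []        = []
cells (row ∷ T) = map (λ (c , x) → c , 0 , x) (rowCells row)
               ++ map (λ (c , r , x) → c , suc r , x) (cells T)

∈-rowCells⁺ : ∀ row c {a} → row !! c ≡ just a → (c , a) ∈ rowCells row
∈-rowCells⁺ (x ∷ row) zero    refl = here refl
∈-rowCells⁺ (x ∷ row) (suc c) e    = there (∈-map⁺ (map₁ suc) (∈-rowCells⁺ row c e))

∈-rowCells⁻ : ∀ row {c a} → (c , a) ∈ rowCells row → row !! c ≡ just a
∈-rowCells⁻ (x ∷ row) (here refl) = refl
∈-rowCells⁻ (x ∷ row) (there m) with _ , m′ , refl ← ∈-map⁻ (map₁ suc) m = ∈-rowCells⁻ row m′

∈-cells⁺ : ∀ T c r {a} → at T c r ≡ just a → (c , r , a) ∈ cells T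
∈-cells⁺ (row ∷ T) c zero    e = ∈-++⁺ˡ (∈-map⁺ _ (∈-rowCells⁺ row c e))
∈-cells⁺ (row ∷ T) c (suc r) e = ∈-++⁺ʳ _ (∈-map⁺ _ (∈-cells⁺ T c r e))

∈-cells⁻ : ∀ T {c r a} → (c , r , a) ∈ cells T → at T c r ≡ just a
∈-cells⁻ (row ∷ T) m with ∈-++⁻ (map _ (rowCells row)) m
... | inj₁ m₀ with _ , m′ , refl ← ∈-map⁻ _ m₀ = ∈-rowCells⁻ row m′
... | inj₂ m₁ with _ , m′ , refl ← ∈-map⁻ _ m₁ = ∈-cells⁻ T m′

module _ {P : ℕ → ℕ → ℕ → Set} (P? : ∀ c r a → Dec (P c r a)) where

  all-cells? : ∀ T → Dec (∀ c r a → at T c r ≡ just a → P c r a)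
  all-cells? T = map′ (λ all c r a e → All.lookup all (∈-cells⁺ T c r e))
                      (λ h → All.tabulate λ m → h _ _ _ (∈-cells⁻ T m))
                      (all? (λ (c , r , a) → P? c r a) (cells T))

  any-cell? : ∀ T → Dec (∃[ c ] ∃[ r ] ∃[ a ] (at T c r ≡ just a × P c r a))
  any-cell? T = map′ (λ any → let (c , r , a) , m , p = find {A = ℕ × ℕ × ℕ} any
                               in c , r , a , ∈-cells⁻ T m , p)
                     (λ (c , r , a , e , p) → lose (∈-cells⁺ T c r e) p)
                     (any? (λ (c , r , a) → P? c r a) (cells T))

-- Cell-level form of the step condition for the value x = v + 1 occurring in column c.
LowerableAt : Tableau → ℕ → ℕ → Set
LowerableAt T c x =
  2 ≤ x × (∀ c′ r′ a → at T c′ r′ ≡ just a → (a ≡ x → c ≤ c′) × (a ≡ pred x → c′ < c))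

lowerableAt? : ∀ T c x → Dec (LowerableAt T c x)
lowerableAt? T c x = (2 ≤? x) ×-dec
  all-cells? (λ c′ r′ a → ((a ≟ x) →-dec (c ≤? c′)) ×-dec ((a ≟ pred x) →-dec (c′ <? c))) T

step? : ∀ T → Dec (∃[ T′ ] DstStep T T′)
step? T = map′ toStep fromStep (any-cell? (λ c _ x → lowerableAt? T c x) T)
  where
  toStep : ∃[ c ] ∃[ r ] ∃[ x ] (at T c r ≡ just x × LowerableAt T c x) → ∃[ T′ ] DstStep T T′
  toStep (c , r , suc (suc u) , e , s≤s (s≤s _) , cond) = -, lowering-step (suc u) c z<s
    ((r , e) , λ c′ r′ e′ → proj₁ (cond c′ r′ _ e′) refl)
    λ c′ r′ e′ → proj₂ (cond c′ r′ _ e′) refl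

  fromStep : ∃[ T′ ] DstStep T T′ → ∃[ c ] ∃[ r ] ∃[ x ] (at T c r ≡ just x × LowerableAt T c x)
  fromStep (_ , v , 1≤v , (c , ((r , e) , leftmost) , left) , _) =
    c , r , suc v , e , s≤s 1≤v ,
    λ c′ r′ _ e′ → (λ { refl → leftmost c′ r′ e′ }) , (λ { refl → left c′ r′ e′ })

module _ {a r} {A : Set a} {_⟶_ : Rel A r} where

  hasNormalForm : (∀ x → Dec (∃ (x ⟶_))) → ∀ {x} → Acc (flip _⟶_) x → HasNormalForm _⟶_ x
  hasNormalForm step? {x} (acc rs) with step? x
  ... | no nf = x , nf , ε
  ... | yes (_ , s) with n , nf , r ← hasNormalForm step? (rs s) = n , nf , s ◅ r

  normalForm-unique : Confluent _⟶_ → ∀ {x m n} → Star _⟶_ x m → Star _⟶_ x n →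
    IsNormalForm _⟶_ m → IsNormalForm _⟶_ n → m ≡ n
  normalForm-unique confluent x↠m x↠n nf-m nf-n with confluent x↠m x↠n
  ... | _ , ε     , ε     = refl
  ... | _ , s ◅ _ , _     = contradiction (-, s) nf-m
  ... | _ , ε     , s ◅ _ = contradiction (-, s) nf-n

dst-normalForm : ∀ T → HasNormalForm DstStep T
dst-normalForm T = hasNormalForm step? (dst-stronglyNormalizing T)

dst : Tableau → Tableau
dst T = proj₁ (dst-normalForm T)

dst-normal : ∀ T → DstNormal (dst T)
dst-normal T = proj₁ (proj₂ (dst-normalForm T))

dst-reach : ∀ T → DstReach T (dst T)
dst-reach T = proj₂ (proj₂ (dst-normalForm T))

dst-unique : ∀ T T′ → DstReach T T′ → DstNormal T′ → T′ ≡ dst T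
dst-unique T T′ T↠T′ nf = normalForm-unique (sn&wcr⇒cr dst⁺-stronglyNormalizing local-confluence)
  T↠T′ (dst-reach T) nf (dst-normal T)

dst-fixes-normal : ∀ T → DstNormal T → dst T ≡ T
dst-fixes-normal T nf = sym (dst-unique T T ε nf)

normal⇒QY : ∀ T → DstNormal T → IsQY T
normal⇒QY T nf v 1≤v c leftmost with any-cell? (λ c′ _ a → (a ≟ v) ×-dec (c ≤? c′)) T
... | yes (c′ , r′ , _ , e , refl , c≤c′) = c′ , r′ , e , c≤c′
... | no none = contradiction (-, lowering-step v c 1≤v leftmost left) nf
  where
  left : AllLeftOf T v c
  left c′ r′ e = ≰⇒> λ c≤c′ → none (c′ , r′ , v , e , refl , c≤c′)

QY⇒normal : ∀ T → IsQY T → DstNormal T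
QY⇒normal T qy (_ , v , 1≤v , (c , leftmost , left) , _) with c′ , r′ , e , c≤c′ ← qy v 1≤v c leftmost =
  <⇒≱ (left c′ r′ e) c≤c′

step-preserves-SSYT : ∀ {n sh T T′} → SSYT n sh T → DstStep T T′ → SSYT n sh T′
step-preserves-SSYT {n} {sh} {T} (shape , rows , columns , bounds)
                    (v , 1≤v , (_ , (_ , leftmost) , left) , refl) =
  trans (shape-mapEntries (lower v) T) shape , rows′ , columns′ , bounds′
  where
  rows′ : ∀ c r a b → at (lowerEntry v T) c r ≡ just a → at (lowerEntry v T) (suc c) r ≡ just b → a ≤ b
  rows′ c r _ _ ea eb with x , ex , refl ← at-mapEntries⁻ (lower v) T c r ea
                         | y , ey , refl ← at-mapEntries⁻ (lower v) T (suc c) r eb =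
    lower-mono-≤ v (rows c r x y ex ey)

  -- A v directly below a v+1 would lie strictly left of the leftmost v+1, in its own column.
  columns′ : ∀ c r a b → at (lowerEntry v T) c r ≡ just a → at (lowerEntry v T) c (suc r) ≡ just b → a < b
  columns′ c r _ _ ea eb with x , ex , refl ← at-mapEntries⁻ (lower v) T c r ea
                            | y , ey , refl ← at-mapEntries⁻ (lower v) T c (suc r) eb =
    lower-mono-< v (columns c r x y ex ey)
      λ { (refl , refl) → <-irrefl refl (<-≤-trans (left c r ex) (leftmost c (suc r) ey)) }

  bounds′ : ∀ c r a → at (lowerEntry v T) c r ≡ just a → 1 ≤ a × a ≤ n
  bounds′ c r _ ea with x , ex , refl ← at-mapEntries⁻ (lower v) T c r ea =
    lower-≥ 1≤v (proj₁ (bounds c r x ex)) , ≤-trans (lower-≤ v x) (proj₂ (bounds c r x ex))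

reach-preserves-SSYT : ∀ {n sh T T′} → SSYT n sh T → DstReach T T′ → SSYT n sh T′
reach-preserves-SSYT t ε       = t
reach-preserves-SSYT t (s ◅ r) = reach-preserves-SSYT (step-preserves-SSYT t s) r

at-column₀ : ∀ T r → All (0 <_) (map length T) → r < length T → ∃[ a ] at T 0 r ≡ just a
at-column₀ ((x ∷ row) ∷ T) zero    _              _         = x , refl
at-column₀ (row ∷ T)       (suc r) (_ ∷ positive) (s≤s r<) = at-column₀ T r positive r<

-- The first column strictly increases through all ℓ rows within {1, …, n};
-- if n ≤ ℓ it must read 1, 2, …, ℓ.
module FirstColumn {n sh T} (t : SSYT n sh T) (positive : All (0 <_) sh) where

  private
    L = length sh
    columns = proj₁ (proj₂ (proj₂ t))
    bounds  = proj₂ (proj₂ (proj₂ t))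

  entry : ∀ r → r < L → ∃[ a ] at T 0 r ≡ just a
  entry r r<L = at-column₀ T r (subst (All (0 <_)) (sym (proj₁ t)) positive)
    (subst (r <_) (sym (trans (sym (length-map length T)) (cong length (proj₁ t)))) r<L)

  entry-≥ : ∀ r {a} → r < L → at T 0 r ≡ just a → suc r ≤ a
  entry-≥ zero    {a} _   e = proj₁ (bounds 0 0 a e)
  entry-≥ (suc r) {a} r<L e with a′ , e′ ← entry r (<-trans (n<1+n r) r<L) =
    <-≤-trans (s≤s (entry-≥ r (<-trans (n<1+n r) r<L) e′)) (columns 0 r a′ a e′ e)

  entry-≤ : ∀ d r {a} → suc (r + d) ≡ L → at T 0 r ≡ just a → a + d ≤ n
  entry-≤ zero    r {a} _  e = subst (_≤ n) (sym (+-identityʳ a)) (proj₂ (bounds 0 r a e))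
  entry-≤ (suc d) r {a} eq e with b , eb ← entry (suc r) (subst (suc r <_) eq (s≤s (m<m+n r z<s))) =
    ≤-trans (subst (_≤ b + d) (sym (+-suc a d)) (+-monoˡ-≤ d (columns 0 r a b e eb)))
            (entry-≤ d (suc r) (trans (cong suc (sym (+-suc r d))) eq) eb)

  entry-≡ : n ≤ L → ∀ r {a} → r < L → at T 0 r ≡ just a → a ≡ suc r
  entry-≡ n≤L r {a} r<L e = ≤-antisym
    (+-cancelʳ-≤ (L ∸ suc r) a (suc r) (≤-trans (entry-≤ (L ∸ suc r) r (m+[n∸m]≡n r<L) e)
                                                (≤-trans n≤L (≤-reflexive (sym (m+[n∸m]≡n r<L))))))
    (entry-≥ r r<L e)

  isQY : n ≤ L → IsQY T
  isQY n≤L (suc u) _ c ((r , e) , leftmost) =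
    0 , u , entry-≡′ u (<-trans (n<1+n u) 2+u≤L) , leftmost 0 (suc u) (entry-≡′ (suc u) 2+u≤L)
    where
    2+u≤L : suc (suc u) ≤ L
    2+u≤L = ≤-trans (proj₂ (bounds c r _ e)) n≤L
    entry-≡′ : ∀ r → r < L → at T 0 r ≡ just (suc r)
    entry-≡′ r r<L with a , ea ← entry r r<L = trans ea (cong just (entry-≡ n≤L r r<L ea))

dst-identity : ∀ {n sh T} → All (0 <_) sh → n ≤ ℓ sh → SSYT n sh T → dst T ≡ T
dst-identity {T = T} positive n≤ℓ t =
  dst-fixes-normal T (QY⇒normal T (FirstColumn.isQY t positive n≤ℓ))

layered : ℕ → ℕ → List ℕ → Tableau
layered k t []           = []
layered k t (x ∷ [])     = replicate x t ∷ []
layered k t (x ∷ y ∷ sh) = replicate x k ∷ layered (suc k) t (y ∷ sh)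

!!-replicate : ∀ {A : Set} x {k : A} c {a} → replicate x k !! c ≡ just a → a ≡ k
!!-replicate (suc x) zero    refl = refl
!!-replicate (suc x) (suc c) e    = !!-replicate x c e

at-layered : ∀ k t sh c r {a} → at (layered k t sh) c r ≡ just a →
  (a ≡ k + r × suc r < length sh) ⊎ (a ≡ t × suc r ≡ length sh)
at-layered k t (x ∷ [])     c zero    e = inj₂ (!!-replicate x c e , refl)
at-layered k t (x ∷ y ∷ sh) c zero    e = inj₁ (trans (!!-replicate x c e) (sym (+-identityʳ k)) , s≤s z<s)
at-layered k t (x ∷ y ∷ sh) c (suc r) e with at-layered (suc k) t (y ∷ sh) c r e
... | inj₁ (a≡ , r<) = inj₁ (trans a≡ (sym (+-suc k r)) , s≤s r<)
... | inj₂ (a≡ , r≡) = inj₂ (a≡ , cong suc r≡)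

at-layered-top : ∀ k t x sh → All (0 <_) (x ∷ sh) → at (layered k t (x ∷ sh)) 0 (length sh) ≡ just t
at-layered-top k t (suc x) []       _              = refl
at-layered-top k t x       (y ∷ sh) (_ ∷ positive) = at-layered-top (suc k) t y sh positive

shape-layered : ∀ k t sh → map length (layered k t sh) ≡ sh
shape-layered k t []           = refl
shape-layered k t (x ∷ [])     = cong (_∷ []) (length-replicate x)
shape-layered k t (x ∷ y ∷ sh) = cong₂ _∷_ (length-replicate x) (shape-layered (suc k) t (y ∷ sh))

layered-SSYT : ∀ n t sh → length sh ≤ t → t ≤ n → SSYT n sh (layered 1 t sh)
layered-SSYT n t sh ℓ≤t t≤n = shape-layered 1 t sh , rows , columns , bounds
  where
  rows : ∀ c r a b → at (layered 1 t sh) c r ≡ just a → at (layered 1 t sh) (suc c) r ≡ just b → a ≤ b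
  rows c r a b ea eb with at-layered 1 t sh c r ea | at-layered 1 t sh (suc c) r eb
  ... | inj₁ (refl , _)  | inj₁ (refl , _)  = ≤-refl
  ... | inj₂ (refl , _)  | inj₂ (refl , _)  = ≤-refl
  ... | inj₁ (_ , r<)    | inj₂ (_ , r≡)    = contradiction r≡ (<⇒≢ r<)
  ... | inj₂ (_ , r≡)    | inj₁ (_ , r<)    = contradiction r≡ (<⇒≢ r<)

  columns : ∀ c r a b → at (layered 1 t sh) c r ≡ just a → at (layered 1 t sh) c (suc r) ≡ just b → a < b
  columns c r a b ea eb with at-layered 1 t sh c r ea | at-layered 1 t sh c (suc r) eb
  ... | inj₁ (refl , _)  | inj₁ (refl , _)  = n<1+n (suc r)
  ... | inj₁ (refl , _)  | inj₂ (refl , r≡) = ≤-trans (≤-reflexive r≡) ℓ≤t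
  ... | inj₂ (_ , r≡)    | inj₁ (_ , r<)    = contradiction r≡ (<⇒≢ (<-trans (n<1+n (suc r)) r<))
  ... | inj₂ (_ , r≡)    | inj₂ (_ , r≡′)   = contradiction (trans r≡′ (sym r≡)) 1+n≢n

  bounds : ∀ c r a → at (layered 1 t sh) c r ≡ just a → 1 ≤ a × a ≤ n
  bounds c r a ea with at-layered 1 t sh c r ea
  ... | inj₁ (refl , r<) = z<s , ≤-trans (<⇒≤ r<) (≤-trans ℓ≤t t≤n)
  ... | inj₂ (refl , r≡) = ≤-trans (s≤s z≤n) (≤-trans (≤-reflexive r≡) ℓ≤t) , t≤n

lowerEntry-layered : ∀ t k sh → k + length sh ≤ suc t →
  lowerEntry t (layered k (suc t) sh) ≡ layered k t sh
lowerEntry-layered t k []           _ = refl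
lowerEntry-layered t k (x ∷ [])     _ =
  cong (_∷ []) (trans (map-replicate (lower t) x (suc t)) (cong (replicate x) (lower-suc t)))
lowerEntry-layered t k (x ∷ y ∷ sh) bound = cong₂ _∷_
  (trans (map-replicate (lower t) x k)
         (cong (replicate x) (lower-≢ (<⇒≢ (<-≤-trans (m<m+n k z<s) bound)))))
  (lowerEntry-layered t (suc k) (y ∷ sh) (≤-trans (≤-reflexive (sym (+-suc k (length (y ∷ sh))))) bound))

-- With ℓ < n the top row of the staircase 1, 2, …, ℓ can be raised to ℓ + 1, and one step undoes that.
dst-not-injective : ∀ n x sh → All (0 <_) (x ∷ sh) → ℓ (x ∷ sh) < n →
  ∃[ T ] ∃[ T′ ] (SSYT n (x ∷ sh) T × SSYT n (x ∷ sh) T′ × dst T ≡ dst T′ × T ≢ T′)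
dst-not-injective n x sh positive ℓ<n =
  raised , staircase ,
  layered-SSYT n (suc L) (x ∷ sh) (n≤1+n L) ℓ<n , staircase-SSYT (<⇒≤ ℓ<n) ,
  trans (sym (dst-unique raised staircase (lowering ◅ ε) staircase-normal))
        (sym (dst-fixes-normal staircase staircase-normal)) ,
  raised≢staircase
  where
  L = ℓ (x ∷ sh)
  raised    = layered 1 (suc L) (x ∷ sh)
  staircase = layered 1 L (x ∷ sh)

  staircase-SSYT : ∀ {m} → L ≤ m → SSYT m (x ∷ sh) staircase
  staircase-SSYT = layered-SSYT _ L (x ∷ sh) ≤-refl

  staircase-normal : DstNormal staircase
  staircase-normal = QY⇒normal staircase (FirstColumn.isQY (staircase-SSYT ≤-refl) positive ≤-refl)

  top : ∀ t → at (layered 1 t (x ∷ sh)) 0 (length sh) ≡ just t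
  top t = at-layered-top 1 t x sh positive

  raised≢staircase : raised ≢ staircase
  raised≢staircase eq =
    1+n≢n (just-injective (trans (sym (top (suc L))) (trans (cong (λ T → at T 0 (length sh)) eq) (top L))))

  no-ℓ : AllLeftOf raised L 0
  no-ℓ c r e with at-layered 1 (suc L) (x ∷ sh) c r e
  ... | inj₁ (a≡ , r<) = contradiction (sym a≡) (<⇒≢ r<)
  ... | inj₂ (a≡ , _)  = contradiction a≡ (1+n≢n ∘ sym)

  lowering : DstStep raised staircase
  lowering = subst (DstStep raised) (lowerEntry-layered L 1 (x ∷ sh) ≤-refl)
    (lowering-step L 0 z<s ((length sh , top (suc L)) , λ _ _ _ → z≤n) no-ℓ)

dst-injective⇔ : ∀ {n sh} → All (0 <_) sh → 0 < ℓ sh →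
  (∀ T T′ → SSYT n sh T → SSYT n sh T′ → dst T ≡ dst T′ → T ≡ T′) ⇔ n ≤ ℓ sh
dst-injective⇔ {n} {x ∷ sh} positive _ = mk⇔
  (λ injective → ≮⇒≥ λ ℓ<n →
    let T , T′ , t , t′ , same-dst , T≢T′ = dst-not-injective n x sh positive ℓ<n
    in T≢T′ (injective T T′ t t′ same-dst))
  (λ n≤ℓ T T′ t t′ same-dst →
    trans (sym (dst-identity positive n≤ℓ t)) (trans same-dst (dst-identity positive n≤ℓ t′)))

dst-QYT : ∀ {n sh T} → SSYT n sh T → QYT n sh (dst T)
dst-QYT {T = T} t = reach-preserves-SSYT t (dst-reach T) , normal⇒QY (dst T) (dst-normal T)

dst-fixed⇔QYT : ∀ {n sh T} → SSYT n sh T → (dst T ≡ T ⇔ QYT n sh T)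
dst-fixed⇔QYT {n} {sh} {T} t = mk⇔
  (λ fixed → subst (QYT n sh) fixed (dst-QYT t))
  (λ (_ , qy) → dst-fixes-normal T (QY⇒normal T qy))

lemma2p6 : (n : ℕ) (λ′ : List ℕ) → 1 ≤ n → IsPartition λ′ →
    Σ (Tableau → Tableau) λ dst →
      (∀ T → SSYT n λ′ T →
        DstReach T (dst T) × DstNormal (dst T) ×
        (∀ T′ → DstReach T T′ → DstNormal T′ → T′ ≡ dst T)) ×
      (∀ T → SSYT n λ′ T → QYT n λ′ (dst T)) ×
      (∀ T → SSYT n λ′ T → (dst T ≡ T ⇔ QYT n λ′ T)) ×
      (∀ Q → QYT n λ′ Q → ∃[ T ] (SSYT n λ′ T × dst T ≡ Q)) ×
      (0 < ℓ λ′ →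
        ((∀ T T′ → SSYT n λ′ T → SSYT n λ′ T′ → dst T ≡ dst T′ → T ≡ T′)
          ⇔ n ≤ ℓ λ′))
lemma2p6 _ _ _ (_ , positive) =
  dst ,
  (λ T _ → dst-reach T , dst-normal T , dst-unique T) ,
  (λ _ → dst-QYT) ,
  (λ _ → dst-fixed⇔QYT) ,
  (λ Q (q , qy) → Q , q , dst-fixes-normal Q (QY⇒normal Q qy)) ,
  dst-injective⇔ positive
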